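{- Every story has a limit assignment: if $\langle W,\sqsubset,f\rangle$ is the underlying dynamic frame of a story, then there is a function $\lim$ assigning to each infinite path $\vec w=(w_i)_{i\ge 0}$ an element $\lim\vec w\in W$ which occurs infinitely often in $\vec w$, such that $\lim\vec f(\vec w)=f(\lim\vec w)$ for every path $\vec w$.
   Context: A transitive relation $\sqsubset$ on a set $A$ (with reflexive closure $\sqsubseteq$) is tree-like if $a\sqsubseteq c$ and $b\sqsubseteq c$ imply $a\sqsubseteq b$ or $b\sqsubseteq a$. A moment is $\langle M,\sqsubset_M,\nu_M,r_M\rangle$ where $M$ is finite, $\sqsubset_M$ is transitive and tree-like on $M$, $r_M$ is a root (with $r_M\sqsubseteq x$ for all $x\in M$), and $\nu_M$ is a valuation. The cluster $C(x)$ of $x$ is $\{y: x\sqsubseteq y\sqsubseteq x\}$; $x$ is reflexive if $x\sqsubset x$. A story of duration $I<\omega$ consists of moments $\mathfrak S_0,\dots,\mathfrak S_I$ and maps $f_i\colon|\mathfrak S_i|\to|\mathfrak S_{i+1}|$ ($i<I$), with $W=\bigsqcup_{i\le I}|\mathfrak S_i|$, $\sqsubset=\bigsqcup_i\sqsubset_i$, root $r_0$, and $f=\mathrm{Id}_{|\mathfrak S_I|}\cup\bigsqcup_{i<I}f_i$, where each $f_i$ is monotonic ($x\sqsubseteq y\Rightarrow f(x)\sqsubseteq f(y)$) and: root preserving ($f_i(r_i)=r_{i+1}$); almost injective (for $x\ne y$ in the same $|\mathfrak S_i|$, $f(x)=f(y)$ implies $f(x)$ irreflexive); cluster-preserving ($C(f(x))=f[C(x)]$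 for every $x\in W$). An (infinite) path is a sequence $(w_i)_{i\ge0}$ in $W$ with $w_i\sqsubseteq w_{i+1}$ for all $i$; $\vec f(\vec w)=(f(w_i))_{i\ge0}$. -}

module Defs where

open import Level using (0ℓ)
open import Data.Nat using (ℕ; zero; suc; _≤_; _<_; _<?_)
open import Data.Fin using (Fin)
open import Data.Bool using (Bool)
open import Data.Product using (Σ; ∃; _×_; _,_; proj₁)
open import Data.Sum using (_⊎_)
open import Relation.Binary.PropositionalEquality using (_≡_; _≢_)
open import Relation.Nullary using (¬_; yes; no)

ReflClo : {A : Set} → (A → A → Set) → A → A → Set
ReflClo R x y = x ≡ y ⊎ R x y

record Moment (PV : Set) : Set₁ where
  field
    size     : ℕ
    _⊏_      : Fin size → Fin size → Set
    ⊏-trans  : ∀ {x y z} → x ⊏ y → y ⊏ z → x ⊏ z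
    treelike : ∀ {a b c} → ReflClo _⊏_ a c → ReflClo _⊏_ b c →
               ReflClo _⊏_ a b ⊎ ReflClo _⊏_ b a
    root     : Fin size
    rootLeast : ∀ x → ReflClo _⊏_ root x
    ν        : PV → Fin size → Bool

open Moment public

∣_∣ : {PV : Set} → Moment PV → Set
∣ M ∣ = Fin (size M)

-- A story of duration I: moments S 0 .. S I (values S i for i > I are
-- irrelevant) and maps f_i : |S i| → |S (i+1)| for i < I with the
-- required properties.
record Story (PV : Set) : Set₁ where
  field
    I    : ℕ
    S    : ℕ → Moment PV
    fmap : (i : ℕ) → i < I → ∣ S i ∣ → ∣ S (suc i) ∣
    monotone : ∀ i (lt : i < I) (x y : ∣ S i ∣) →
               ReflClo (_⊏_ (S i)) x y →
               ReflClo (_⊏_ (S (suc i))) (fmap i lt x) (fmap i lt y)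
    rootPres : ∀ i (lt : i < I) → fmap i lt (root (S i)) ≡ root (S (suc i))
    almostInj : ∀ i (lt : i < I) (x y : ∣ S i ∣) → x ≢ y →
                fmap i lt x ≡ fmap i lt y →
                ¬ (_⊏_ (S (suc i)) (fmap i lt x) (fmap i lt x))
    -- C(f x) = f[C x], as an extensional equality of subsets
    clusterPres : ∀ i (lt : i < I) (x : ∣ S i ∣) (z : ∣ S (suc i) ∣) →
      ((ReflClo (_⊏_ (S (suc i))) (fmap i lt x) z ×
        ReflClo (_⊏_ (S (suc i))) z (fmap i lt x)) →
         Σ ∣ S i ∣ λ y → (ReflClo (_⊏_ (S i)) x y × ReflClo (_⊏_ (S i)) y x)
                         × fmap i lt y ≡ z)
      × ((Σ ∣ S i ∣ λ y → (ReflClo (_⊏_ (S i)) x y × ReflClo (_⊏_ (S i)) y x)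
                         × fmap i lt y ≡ z) →
         (ReflClo (_⊏_ (S (suc i))) (fmap i lt x) z ×
          ReflClo (_⊏_ (S (suc i))) z (fmap i lt x)))

module _ {PV : Set} (𝔖 : Story PV) where
  open Story 𝔖

  W : Set
  W = Σ ℕ λ i → i ≤ I × ∣ S i ∣

  data _⊏W_ : W → W → Set where
    within : ∀ {i p q x y} → _⊏_ (S i) x y → (i , p , x) ⊏W (i , q , y)

  _⊑W_ : W → W → Set
  _⊑W_ = ReflClo _⊏W_

  fW : W → W
  fW (i , p , x) with i <? I
  ... | yes lt = (suc i , lt , fmap i lt x)
  ... | no _   = (i , p , x)

  IsPath : (ℕ → W) → Set
  IsPath w = ∀ n → w n ⊑W w (suc n)

  InfOften : (ℕ → W) → W → Set
  InfOften w x = ∀ n → ∃ λ m → n ≤ m × w m ≡ x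

  -- a limit assignment (lim is given on all sequences; only its values
  -- on paths are constrained)
  LimitAssignment : ((ℕ → W) → W) → Set
  LimitAssignment lim =
    (∀ w → IsPath w → InfOften w (lim w)) ×
    (∀ w → IsPath w → lim (λ n → fW (w n)) ≡ fW (lim w))

-- A path stays inside one moment, a finite set, so some point of it
-- recurs.  Limits are chosen backwards from the last moment S I, where f
-- is the identity and any recurring point will do.  Below it, if y recurs
-- in f ∘ w then, since f (w m) = y for infinitely many m and these w m
-- range over a finite set, some x with f x = y recurs in w; choosing such
-- an x as the limit of w makes lim commute with f.  Excluded middle is
-- what turns these existence statements into a choice function.
module Submission where

open import Defs
open import Level using (0ℓ)
open import Axiom.ExcludedMiddle using (ExcludedMiddle)
open import Axiom.DoubleNegationElimination using (em⇒dne)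
open import Data.Nat using (ℕ; zero; suc; _≤_; _<_; _<?_; _∸_; _⊔_)
open import Data.Nat.Properties using (≤-irrelevant; ≤-refl; ≤-trans; m≤m⊔n; m≤n⊔m; +-∸-assoc)
open import Data.Product using (Σ; ∃; _×_; _,_; proj₁; proj₂)
import Data.Product as Product
import Data.Sum as Sum
open import Data.Unit using (⊤; tt)
open import Data.List using (List; []; _∷_; map; allFin)
open import Data.List.Relation.Unary.Any using (Any; here; there)
open import Data.List.Membership.Propositional using (_∈_; lose)
open import Data.List.Membership.Propositional.Properties using (∈-map⁺; ∈-allFin)
open import Function using (_∘_)
open import Relation.Binary.PropositionalEquality
  using (_≡_; refl; sym; trans; cong; subst; module ≡-Reasoning)
open import Relation.Nullary using (¬_; yes; no; contradiction)
open import Relation.Nullary.Decidable using (toSum)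
open import Relation.Unary using (_⊆_; _≐_)

Infinite : (ℕ → Set) → Set
Infinite P = ∀ n → ∃ λ m → n ≤ m × P m

Infinite-mono : {P Q : ℕ → Set} → P ⊆ Q → Infinite P → Infinite Q
Infinite-mono P⊆Q inf n = Product.map₂ (Product.map₂ P⊆Q) (inf n)

Infinite-beyond : {P : ℕ → Set} → Infinite P → ∀ N → Infinite (λ m → N ≤ m × P m)
Infinite-beyond inf N n with inf (n ⊔ N)
... | m , n⊔N≤m , pm =
  m , ≤-trans (m≤m⊔n n N) n⊔N≤m , ≤-trans (m≤n⊔m n N) n⊔N≤m , pm

module Classical (lem : ExcludedMiddle 0ℓ) where

  ¬Infinite⇒eventually¬ : {P : ℕ → Set} → ¬ Infinite P → ∃ λ N → ∀ m → N ≤ m → ¬ P m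
  ¬Infinite⇒eventually¬ fin = dne λ ¬eventually → fin λ n →
    dne λ ¬found → ¬eventually (n , λ m n≤m pm → ¬found (m , n≤m , pm))
    where dne = em⇒dne lem

  infinite-pigeonhole : {A : Set} (a : ℕ → A) (xs : List A) {P : ℕ → Set} →
    (∀ {m} → P m → a m ∈ xs) → Infinite P →
    ∃ λ x → Infinite (λ m → P m × a m ≡ x)
  infinite-pigeonhole a [] P⇒∈ inf with P⇒∈ (proj₂ (proj₂ (inf 0)))
  ... | ()
  infinite-pigeonhole a (x ∷ xs) {P} P⇒∈ inf with lem {Infinite (λ m → P m × a m ≡ x)}
  ... | yes x-recurs = x , x-recurs
  ... | no x-stops with ¬Infinite⇒eventually¬ x-stops
  ... | N , not-x-beyond-N =
    Product.map₂ (Infinite-mono (Product.map₁ proj₂))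
      (infinite-pigeonhole a xs P⇒∈xs (Infinite-beyond inf N))
    where
    P⇒∈xs : ∀ {m} → N ≤ m × P m → a m ∈ xs
    P⇒∈xs {m} (N≤m , pm) with P⇒∈ pm
    ... | here am≡x = contradiction (pm , am≡x) (not-x-beyond-N m N≤m)
    ... | there am∈xs = am∈xs

  firstSuch : {A : Set} → (A → Set) → A → List A → A
  firstSuch P default [] = default
  firstSuch P default (x ∷ xs) with lem {P x}
  ... | yes _ = x
  ... | no _ = firstSuch P default xs

  firstSuch-satisfies : {A : Set} {P : A → Set} (default : A) {xs : List A} →
    Any P xs → P (firstSuch P default xs)
  firstSuch-satisfies {P = P} default {x ∷ xs} any with lem {P x}
  ... | yes px = px
  firstSuch-satisfies default (here px) | no ¬px = contradiction px ¬px
  firstSuch-satisfies default (there any) | no _ = firstSuch-satisfies default any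

  firstSuch-cong : {A : Set} {P Q : A → Set} (default : A) (xs : List A) →
    P ≐ Q → firstSuch P default xs ≡ firstSuch Q default xs
  firstSuch-cong default [] _ = refl
  firstSuch-cong {P = P} {Q} default (x ∷ xs) P≐Q with lem {P x} | lem {Q x}
  ... | yes _  | yes _  = refl
  ... | yes px | no ¬qx = contradiction (proj₁ P≐Q px) ¬qx
  ... | no ¬px | yes qx = contradiction (proj₂ P≐Q qx) ¬px
  ... | no _   | no _   = firstSuch-cong default xs P≐Q

module Frame {PV : Set} (𝔖 : Story PV) where
  open Story 𝔖

  level : W 𝔖 → ℕ
  level = proj₁

  layer : W 𝔖 → List (W 𝔖)
  layer (i , i≤I , _) = map (λ y → i , i≤I , y) (allFin (size (S i)))

  ∈-layer : ∀ a b → level a ≡ level b → a ∈ layer b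
  ∈-layer (i , i≤I , x) (.i , i≤I′ , _) refl
    rewrite ≤-irrelevant i≤I i≤I′ = ∈-map⁺ (λ y → i , i≤I′ , y) (∈-allFin x)

  ⊑-level : ∀ {a b} → _⊑W_ 𝔖 a b → level a ≡ level b
  ⊑-level (Sum.inj₁ refl) = refl
  ⊑-level (Sum.inj₂ (within _)) = refl

  path-level : ∀ {w} → IsPath 𝔖 w → ∀ n → level (w n) ≡ level (w 0)
  path-level pw zero = refl
  path-level pw (suc n) = trans (sym (⊑-level (pw n))) (path-level pw n)

  path-⊆-layer : ∀ {w} → IsPath 𝔖 w → ∀ n → w n ∈ layer (w 0)
  path-⊆-layer {w} pw n = ∈-layer (w n) (w 0) (path-level pw n)

  recurring-level : ∀ {w x} → IsPath 𝔖 w → InfOften 𝔖 w x → level x ≡ level (w 0)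
  recurring-level pw x-recurs with x-recurs 0
  ... | m , _ , refl = path-level pw m

  InfOften-cong : ∀ {w w′} → (∀ n → w n ≡ w′ n) → InfOften 𝔖 w ⊆ InfOften 𝔖 w′
  InfOften-cong w≗w′ = Infinite-mono λ {m} → trans (sym (w≗w′ m))

  fW-level : ∀ a → level a < I → level (fW 𝔖 a) ≡ suc (level a)
  fW-level (i , _ , _) i<I with i <? I
  ... | yes _ = refl
  ... | no i≮I = contradiction i<I i≮I

  fW-last : ∀ a → ¬ level a < I → fW 𝔖 a ≡ a
  fW-last (i , _ , _) i≮I with i <? I
  ... | yes i<I = contradiction i<I i≮I
  ... | no _ = refl

  fW-mono : ∀ {a b} → _⊑W_ 𝔖 a b → _⊑W_ 𝔖 (fW 𝔖 a) (fW 𝔖 b)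
  fW-mono (Sum.inj₁ refl) = Sum.inj₁ refl
  fW-mono (Sum.inj₂ (within {i} {x = x} {y} x⊏y)) with i <? I
  ... | yes i<I = Sum.map (cong (λ z → suc i , i<I , z)) within
                          (monotone i i<I x y (Sum.inj₂ x⊏y))
  ... | no _ = Sum.inj₂ (within x⊏y)

  fW-path : ∀ {w} → IsPath 𝔖 w → IsPath 𝔖 (fW 𝔖 ∘ w)
  fW-path pw = fW-mono ∘ pw

  module Limits (lem : ExcludedMiddle 0ℓ) where
    open Classical lem

    pigeonhole-on-path : ∀ {w} {P : ℕ → Set} → IsPath 𝔖 w → Infinite P →
      ∃ λ x → x ∈ layer (w 0) × Infinite (λ m → P m × w m ≡ x)
    pigeonhole-on-path {w} pw inf
      with infinite-pigeonhole w (layer (w 0)) (λ {m} _ → path-⊆-layer pw m) inf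
    ... | x , x-recurs with x-recurs 0
    ...   | m , _ , _ , refl = w m , path-⊆-layer pw m , x-recurs

    recurring-point : ∀ {w} → IsPath 𝔖 w → Any (InfOften 𝔖 w) (layer (w 0))
    recurring-point pw with pigeonhole-on-path {P = λ _ → ⊤} pw (λ n → n , ≤-refl , tt)
    ... | x , x∈layer , x-recurs = lose x∈layer (Infinite-mono proj₂ x-recurs)

    recurring-preimage : ∀ {w y} → IsPath 𝔖 w → InfOften 𝔖 (fW 𝔖 ∘ w) y →
      Any (λ x → InfOften 𝔖 w x × fW 𝔖 x ≡ y) (layer (w 0))
    recurring-preimage pw y-recurs with pigeonhole-on-path pw y-recurs
    ... | x , x∈layer , x-recurs with x-recurs 0
    ...   | _ , _ , fwm≡y , refl =
      lose x∈layer (Infinite-mono proj₂ x-recurs , fwm≡y)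

    -- Opaque, so that unification sees select P a and can infer P in select-cong.
    opaque
      select : (W 𝔖 → Set) → W 𝔖 → W 𝔖
      select P a = firstSuch P a (layer a)

      select-satisfies : ∀ {P} a → Any P (layer a) → P (select P a)
      select-satisfies a = firstSuch-satisfies a

      select-cong : ∀ {P Q a a′} → a ≡ a′ → P ≐ Q → select P a ≡ select Q a′
      select-cong {a = a} refl = firstSuch-cong a (layer a)

    -- The limit of a path lying in the moment S (I ∸ d).
    limAtDepth : ℕ → (ℕ → W 𝔖) → W 𝔖
    limAtDepth zero w = select (InfOften 𝔖 w) (w 0)
    limAtDepth (suc d) w =
      select (λ x → InfOften 𝔖 w x × fW 𝔖 x ≡ limAtDepth d (fW 𝔖 ∘ w)) (w 0)

    limAtDepth-recurs : ∀ d {w} → IsPath 𝔖 w → InfOften 𝔖 w (limAtDepth d w)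
    limAtDepth-suc : ∀ d {w} → IsPath 𝔖 w →
      InfOften 𝔖 w (limAtDepth (suc d) w) × fW 𝔖 (limAtDepth (suc d) w) ≡ limAtDepth d (fW 𝔖 ∘ w)

    limAtDepth-recurs zero {w} pw = select-satisfies (w 0) (recurring-point pw)
    limAtDepth-recurs (suc d) pw = proj₁ (limAtDepth-suc d pw)

    limAtDepth-suc d {w} pw = select-satisfies (w 0)
      (recurring-preimage pw (limAtDepth-recurs d (fW-path pw)))

    limAtDepth-cong : ∀ d {w w′} → (∀ n → w n ≡ w′ n) → limAtDepth d w ≡ limAtDepth d w′
    limAtDepth-cong zero w≗w′ =
      select-cong (w≗w′ 0) (InfOften-cong w≗w′ , InfOften-cong (sym ∘ w≗w′))
    limAtDepth-cong (suc d) w≗w′ = select-cong (w≗w′ 0)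
      ( Product.map (InfOften-cong w≗w′) (λ eq → trans eq ih)
      , Product.map (InfOften-cong (sym ∘ w≗w′)) (λ eq → trans eq (sym ih)))
      where ih = limAtDepth-cong d (cong (fW 𝔖) ∘ w≗w′)

    lim : (ℕ → W 𝔖) → W 𝔖
    lim w = limAtDepth (I ∸ level (w 0)) w

    lim-recurs : ∀ w → IsPath 𝔖 w → InfOften 𝔖 w (lim w)
    lim-recurs w = limAtDepth-recurs (I ∸ level (w 0))

    lim-commutes-below : ∀ w → IsPath 𝔖 w → level (w 0) < I →
      lim (fW 𝔖 ∘ w) ≡ fW 𝔖 (lim w)
    lim-commutes-below w pw i<I = begin
      limAtDepth (I ∸ level (fW 𝔖 (w 0))) (fW 𝔖 ∘ w)
        ≡⟨ cong (λ j → limAtDepth (I ∸ j) (fW 𝔖 ∘ w)) (fW-level (w 0) i<I) ⟩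
      limAtDepth (I ∸ suc (level (w 0))) (fW 𝔖 ∘ w)
        ≡⟨ sym (proj₂ (limAtDepth-suc (I ∸ suc (level (w 0))) pw)) ⟩
      fW 𝔖 (limAtDepth (suc (I ∸ suc (level (w 0)))) w)
        ≡⟨ cong (λ d → fW 𝔖 (limAtDepth d w)) (sym (+-∸-assoc 1 i<I)) ⟩
      fW 𝔖 (lim w) ∎
      where open ≡-Reasoning

    lim-commutes-last : ∀ w → IsPath 𝔖 w → ¬ level (w 0) < I →
      lim (fW 𝔖 ∘ w) ≡ fW 𝔖 (lim w)
    lim-commutes-last w pw i≮I = begin
      lim (fW 𝔖 ∘ w)
        ≡⟨ cong (λ a → limAtDepth (I ∸ level a) (fW 𝔖 ∘ w)) (fW-id 0) ⟩
      limAtDepth (I ∸ level (w 0)) (fW 𝔖 ∘ w)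
        ≡⟨ limAtDepth-cong (I ∸ level (w 0)) fW-id ⟩
      lim w
        ≡⟨ sym (fW-last (lim w) (i≮I ∘ subst (_< I) (recurring-level pw (lim-recurs w pw)))) ⟩
      fW 𝔖 (lim w) ∎
      where
      open ≡-Reasoning
      fW-id : ∀ n → fW 𝔖 (w n) ≡ w n
      fW-id n = fW-last (w n) (i≮I ∘ subst (_< I) (path-level pw n))

    lim-commutes : ∀ w → IsPath 𝔖 w → lim (fW 𝔖 ∘ w) ≡ fW 𝔖 (lim w)
    lim-commutes w pw =
      Sum.[ lim-commutes-below w pw , lim-commutes-last w pw ]′ (toSum (level (w 0) <? I))

mainTheorem6 : ExcludedMiddle 0ℓ → {PV : Set} → (𝔖 : Story PV) →
    Σ ((ℕ → W 𝔖) → W 𝔖) (LimitAssignment 𝔖)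
mainTheorem6 lem 𝔖 = lim , lim-recurs , lim-commutes
  where open Frame.Limits 𝔖 lem
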